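{- If $\mathcal{M}\vDash\mathsf{DB}_0+\mathsf{TCo}$, then every taller $\Sigma_2$-elementary extension of $\mathcal{M}$ is taller*.
   Context: Language $\mathcal{L}_\in=\{\in,=\}$. $\mathsf{DB}_0$ consists of extensionality, nullset, pairing, union, cartesian product and $\Delta_0$-separation. $\mathsf{TCo}$ (transitive containment) is the axiom stating that every set is an element of some transitive set. For $\mathcal{L}_\in$-structures $\mathcal{M}\subseteq\mathcal{N}$: $\mathcal{N}$ is taller than $\mathcal{M}$ if there is $n\in N$ such that $\mathcal{N}\vDash m\in n$ for every $m\in M$; $\mathcal{N}$ is taller* than $\mathcal{M}$ if moreover such an $n$ can be chosen with $\mathcal{N}\vDash$ "$n$ is a transitive set". $\mathcal{M}\prec_{\Sigma_2}\mathcal{N}$ means $\Sigma_2$ formulas with parameters in $M$ have the same truth value in both. -}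

module Defs where

open import Data.Nat using (ℕ; zero; suc)
open import Data.Fin using (Fin; zero; suc)
open import Data.Product using (Σ; ∃; _×_; _,_)
open import Data.Sum using (_⊎_)
open import Data.Empty using (⊥)
open import Relation.Nullary using (¬_)
open import Relation.Binary.PropositionalEquality using (_≡_)
open import Function.Bundles using (_⇔_)

-- L_∈ = {∈, =}-structures.  Equality is interpreted as real identity (≡).

record Structure : Set₁ where
  field
    Carrier : Set
    _∈_     : Carrier → Carrier → Set

open Structure public

data Fm (n : ℕ) : Set where
  _∈̇_ : Fin n → Fin n → Fm n
  _≐_ : Fin n → Fin n → Fm n
  ⊥̇   : Fm n
  ¬̇_  : Fm n → Fm n
  _∧̇_ _∨̇_ _⇒̇_ : Fm n → Fm n → Fm n
  ∀̇ ∃̇  : Fm (suc n) → Fm n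

∀∈ : {n : ℕ} → Fin n → Fm (suc n) → Fm n
∀∈ y φ = ∀̇ ((zero ∈̇ suc y) ⇒̇ φ)

∃∈ : {n : ℕ} → Fin n → Fm (suc n) → Fm n
∃∈ y φ = ∃̇ ((zero ∈̇ suc y) ∧̇ φ)

data IsΔ₀ {n : ℕ} : Fm n → Set where
  mem  : ∀ i j → IsΔ₀ (i ∈̇ j)
  eq   : ∀ i j → IsΔ₀ (i ≐ j)
  bot  : IsΔ₀ ⊥̇
  neg  : ∀ {φ} → IsΔ₀ φ → IsΔ₀ (¬̇ φ)
  conj : ∀ {φ ψ} → IsΔ₀ φ → IsΔ₀ ψ → IsΔ₀ (φ ∧̇ ψ)
  disj : ∀ {φ ψ} → IsΔ₀ φ → IsΔ₀ ψ → IsΔ₀ (φ ∨̇ ψ)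
  impl : ∀ {φ ψ} → IsΔ₀ φ → IsΔ₀ ψ → IsΔ₀ (φ ⇒̇ ψ)
  ball : ∀ y {φ} → IsΔ₀ φ → IsΔ₀ (∀∈ y φ)
  bex  : ∀ y {φ} → IsΔ₀ φ → IsΔ₀ (∃∈ y φ)

mutual
  data IsΣ : ℕ → {n : ℕ} → Fm n → Set where
    Σ-Δ₀ : ∀ {n} {φ : Fm n} → IsΔ₀ φ → IsΣ zero φ
    Σ-Π  : ∀ {k n} {φ : Fm n} → IsΠ k φ → IsΣ (suc k) φ
    Σ-∃  : ∀ {k n} {φ : Fm (suc n)} → IsΣ (suc k) φ → IsΣ (suc k) (∃̇ φ)

  data IsΠ : ℕ → {n : ℕ} → Fm n → Set where
    Π-Δ₀ : ∀ {n} {φ : Fm n} → IsΔ₀ φ → IsΠ zero φ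
    Π-Σ  : ∀ {k n} {φ : Fm n} → IsΣ k φ → IsΠ (suc k) φ
    Π-∀  : ∀ {k n} {φ : Fm (suc n)} → IsΠ (suc k) φ → IsΠ (suc k) (∀̇ φ)

-- Satisfaction (Tarskian; classical once excluded middle is assumed).

_∷ₑ_ : {A : Set} {n : ℕ} → A → (Fin n → A) → Fin (suc n) → A
(a ∷ₑ ρ) zero    = a
(a ∷ₑ ρ) (suc i) = ρ i

Sat : (M : Structure) {n : ℕ} → (Fin n → Carrier M) → Fm n → Set
Sat M ρ (i ∈̇ j) = _∈_ M (ρ i) (ρ j)
Sat M ρ (i ≐ j) = ρ i ≡ ρ j
Sat M ρ ⊥̇       = ⊥
Sat M ρ (¬̇ φ)   = ¬ Sat M ρ φ
Sat M ρ (φ ∧̇ ψ) = Sat M ρ φ × Sat M ρ ψ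
Sat M ρ (φ ∨̇ ψ) = Sat M ρ φ ⊎ Sat M ρ ψ
Sat M ρ (φ ⇒̇ ψ) = Sat M ρ φ → Sat M ρ ψ
Sat M ρ (∀̇ φ)   = (a : Carrier M) → Sat M (a ∷ₑ ρ) φ
Sat M ρ (∃̇ φ)   = Σ (Carrier M) λ a → Sat M (a ∷ₑ ρ) φ

module _ (M : Structure) where
  private
    U = Carrier M
    _∈M_ = _∈_ M

  IsEmpty : U → Set
  IsEmpty x = ∀ y → ¬ (y ∈M x)

  IsUPair : U → U → U → Set
  IsUPair w x y = ∀ v → (v ∈M w) ⇔ (v ≡ x ⊎ v ≡ y)

  IsOPair : U → U → U → Set
  IsOPair z x y = ∀ w → (w ∈M z) ⇔ (IsUPair w x x ⊎ IsUPair w x y)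

  IsTransitive : U → Set
  IsTransitive t = ∀ x y → x ∈M t → y ∈M x → y ∈M t

  Extensionality : Set
  Extensionality = ∀ x y → (∀ z → (z ∈M x) ⇔ (z ∈M y)) → x ≡ y

  Nullset : Set
  Nullset = ∃ λ x → IsEmpty x

  Pairing : Set
  Pairing = ∀ x y → ∃ λ w → IsUPair w x y

  Union : Set
  Union = ∀ x → ∃ λ u → ∀ w → (w ∈M u) ⇔ (∃ λ v → v ∈M x × w ∈M v)

  CartesianProduct : Set
  CartesianProduct = ∀ a b → ∃ λ c → ∀ z →
    (z ∈M c) ⇔ (∃ λ x → ∃ λ y → x ∈M a × y ∈M b × IsOPair z x y)

  Δ₀-Separation : Set
  Δ₀-Separation = ∀ {n} (φ : Fm (suc n)) → IsΔ₀ φ → (ρ : Fin n → U) → ∀ w →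
    ∃ λ y → ∀ x → (x ∈M y) ⇔ (x ∈M w × Sat M (x ∷ₑ ρ) φ)

  ⊨DB₀ : Set
  ⊨DB₀ = Extensionality × Nullset × Pairing × Union × CartesianProduct × Δ₀-Separation

  ⊨TCo : Set
  ⊨TCo = ∀ x → ∃ λ t → IsTransitive t × x ∈M t

-- Extensions M ⊆ N, presented (up to isomorphism) by an embedding e : M → N
-- that is injective and preserves and reflects ∈ (so M is a substructure).

record Extension (M N : Structure) : Set where
  field
    emb       : Carrier M → Carrier N
    injective : ∀ a b → emb a ≡ emb b → a ≡ b
    pres-∈    : ∀ a b → (_∈_ M a b) ⇔ (_∈_ N (emb a) (emb b))

open Extension public

IsΣ₂Elementary : {M N : Structure} → Extension M N → Set
IsΣ₂Elementary {M} {N} E = ∀ {n} (φ : Fm n) → IsΣ 2 φ → (ρ : Fin n → Carrier M) →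
  Sat M ρ φ ⇔ Sat N (λ i → emb E (ρ i)) φ

Taller : {M N : Structure} → Extension M N → Set
Taller {M} {N} E = ∃ λ (n : Carrier N) → ∀ m → _∈_ N (emb E m) n

Taller* : {M N : Structure} → Extension M N → Set
Taller* {M} {N} E = ∃ λ (n : Carrier N) → IsTransitive N n × (∀ m → _∈_ N (emb E m) n)

{-# OPTIONS --safe #-}
module Submission where

-- "Some set lies in no transitive set" is a Σ₂ sentence.  It fails in M by TCo,
-- so by Σ₂-elementarity it fails in N as well, i.e. N ⊨ TCo (classically).  A
-- transitive set of N containing the witness n of tallness then contains every
-- element of M.

open import Defs
open import Level using (0ℓ)
open import Axiom.ExcludedMiddle using (ExcludedMiddle)
open import Axiom.DoubleNegationElimination using (em⇒dne)
open import Data.Nat using (ℕ; suc)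
open import Data.Fin using (Fin; zero; suc)
open import Data.Product using (∃; _×_; _,_)
open import Relation.Nullary using (¬_)
open import Function.Bundles using (Equivalence)

IsTransitivelyContained : (M : Structure) → Carrier M → Set
IsTransitivelyContained M x = ∃ λ t → IsTransitive M t × _∈_ M x t

isTransitivė : {n : ℕ} → Fm (suc n)
isTransitivė = ∀∈ zero (∀∈ zero (zero ∈̇ suc (suc zero)))

isTransitivė-Δ₀ : {n : ℕ} → IsΔ₀ (isTransitivė {n})
isTransitivė-Δ₀ = ball zero (ball zero (mem zero (suc (suc zero))))

Sat-isTransitivė⇒IsTransitive : (M : Structure) {n : ℕ} (ρ : Fin (suc n) → Carrier M) →
  Sat M ρ isTransitivė → IsTransitive M (ρ zero)
Sat-isTransitivė⇒IsTransitive M ρ sat a b a∈t b∈a = sat a a∈t b b∈a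

IsTransitive⇒Sat-isTransitivė : (M : Structure) {n : ℕ} (ρ : Fin (suc n) → Carrier M) →
  IsTransitive M (ρ zero) → Sat M ρ isTransitivė
IsTransitive⇒Sat-isTransitivė M ρ tr a a∈t b b∈a = tr a b a∈t b∈a

¬TCȯ : Fm 0
¬TCȯ = ∃̇ (∀̇ (¬̇ (isTransitivė ∧̇ (suc zero ∈̇ zero))))

¬TCȯ-Σ₂ : IsΣ 2 ¬TCȯ
¬TCȯ-Σ₂ = Σ-∃ (Σ-Π (Π-∀ (Π-Σ (Σ-Δ₀ (neg (conj isTransitivė-Δ₀ (mem (suc zero) zero)))))))

⊨TCo⇒¬Sat-¬TCȯ : (M : Structure) (ρ : Fin 0 → Carrier M) → ⊨TCo M → ¬ Sat M ρ ¬TCȯ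
⊨TCo⇒¬Sat-¬TCȯ M ρ tco (x , uncontained) with tco x
... | t , t-tr , x∈t = uncontained t (IsTransitive⇒Sat-isTransitivė M (t ∷ₑ (x ∷ₑ ρ)) t-tr , x∈t)

uncontained⇒Sat-¬TCȯ : (M : Structure) (ρ : Fin 0 → Carrier M) (x : Carrier M) →
  ¬ IsTransitivelyContained M x → Sat M ρ ¬TCȯ
uncontained⇒Sat-¬TCȯ M ρ x uncontained =
  x , λ t (t-tr , x∈t) → uncontained (t , Sat-isTransitivė⇒IsTransitive M (t ∷ₑ (x ∷ₑ ρ)) t-tr , x∈t)

Σ₂-elementary-¬¬TCo : {M N : Structure} (E : Extension M N) → IsΣ₂Elementary E → ⊨TCo M →
  (x : Carrier N) → ¬ ¬ IsTransitivelyContained N x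
Σ₂-elementary-¬¬TCo {M} {N} E elem tco x uncontained =
  ⊨TCo⇒¬Sat-¬TCȯ M ρ tco
    (Equivalence.from (elem ¬TCȯ ¬TCȯ-Σ₂ ρ) (uncontained⇒Sat-¬TCȯ N (λ i → emb E (ρ i)) x uncontained))
  where
    ρ : Fin 0 → Carrier M
    ρ ()

transitivelyContained⇒Taller* : {M N : Structure} (E : Extension M N) (n : Carrier N) →
  (∀ m → _∈_ N (emb E m) n) → IsTransitivelyContained N n → Taller* E
transitivelyContained⇒Taller* E n all∈n (t , t-tr , n∈t) =
  t , t-tr , λ m → t-tr n (emb E m) n∈t (all∈n m)

mainTheorem10 : ExcludedMiddle 0ℓ → (M : Structure) → ⊨DB₀ M → ⊨TCo M →
    (N : Structure) → (E : Extension M N) → IsΣ₂Elementary E → Taller E → Taller* E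
mainTheorem10 em M _ tco N E elem (n , all∈n) =
  transitivelyContained⇒Taller* E n all∈n (em⇒dne em (Σ₂-elementary-¬¬TCo E elem tco n))
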